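{- Let $\Gamma$ be a tree on a finite set $\Pi$ and let $\{\Pi_1,\Pi_2\}$ be a principal decomposition of $\Gamma$, with principal orientation $o_{\Pi_1,\Pi_2}$. Regard $\widetilde{Ord}(\Pi_1)$ as a set of partial orders on $\Pi_1$ as described in the context. Then: 1. $\widetilde{Ord}(\Pi_1)$ equals the set of partial orders $\tilde d$ on $\Pi_1$ such that (i) $\tilde d$ is a rooted tree, (ii) for every $\beta\in\Pi_2$ the restriction of $\tilde d$ to $Nbd(\beta)$ is a total order, and (iii) $\tilde d$ is minimal with respect to (i) and (ii): if a partial order $\tilde f$ on $\Pi_1$ satisfies (i), (ii) and $\tilde f\le\tilde d$, then $\tilde f=\tilde d$. 2. Let $\widetilde{Ord}_{\Pi_1,\Pi_2}(\Pi)$ be the set of partial orders $\tilde e$ on $\Pi$ such that (i) $\tilde e$ is a rooted tree, (ii) $o_{\Pi_1,\Pi_2}\le\tilde e$, i.e. $\alpha<_{\tilde e}\beta$ for every edge $\overline{\alpha\beta}$ with $\alpha\in\Pi_1$, $\beta\in\Pi_2$, (iii) no two distinct elements of $\Pi_2$ are comparable in $\tilde e$, and (iv) $\tilde e$ is minimal with respect to (i), (ii), (iii): if $\tilde f$ satisfies (i)–(iii) and $\tilde f\le\tilde e$ then $\tilde f=\tilde e$. Then the lifting $\tilde d\mapsto\tilde{od}$ is a bijection $\widetilde{Ord}(\Pi_1)\to\widetilde{Ord}_{\Pi_1,\Pi_2}(\Pi)$. 3. The set $\Sigma(o_{\Pi_1,\Pi_2})$ is the disjoint union $$\Sigma(o_{\Pi_1,\Pi_2})=\coprod_{\tilde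 e\in\widetilde{Ord}_{\Pi_1,\Pi_2}(\Pi)}\Sigma(\tilde e).$$
   Context: $\Gamma$ is a tree with vertex set $\Pi$; a principal decomposition is an ordered pair $\{\Pi_1,\Pi_2\}$ with $\Pi=\Pi_1\sqcup\Pi_2$ and no edge inside either $\Pi_i$. The principal orientation $o_{\Pi_1,\Pi_2}$ orients each edge from its $\Pi_1$-endpoint to its $\Pi_2$-endpoint. For a partial order (or acyclic oriented graph, via its transitive closure) $p$ on a set $X$, $\Sigma(p)$ is the set of linear orderings $c$ of $X$ extending $p$ (i.e. $x<_py\Rightarrow x<_cy$). For partial orders, $\tilde f\le\tilde e$ means $x<_{\tilde f}y\Rightarrow x<_{\tilde e}y$. A partial order on a finite set is a rooted tree if it has a unique minimal element (the root) and every other element has exactly one immediate predecessor (equivalently its Hasse diagram is a tree oriented away from the root). For $\beta\in\Pi$, $Nbd(\beta)=\{u\in\Pi\mid\overline{\beta u}$ is an edge of $\Gamma\}$. For a linear ordering $d$ of $\Pi_1$ and $v\in\Pi_1$, $\Gamma_{d,v}$ is the connected component containing $v$ of the subgraph of $\Gamma$ induced on $\Pi\setminus\{w\in\Pi_1\mid w<_dv\}$; $d,d'$ are equivalent if $\Gamma_{d,v}=\Gamma_{d',v}$ for all $v\in\Pi_1$, and $\widetilde{Ord}(\Pi_1)$ is the set of equivalence classes. To the class $\tilde d$ of $d$ one attaches the partial order $\le_{\tilde d}$ on $\Pi_1$ defined by $v'\le_{\tilde d}v$ iff $v\in\Gamma_{d,v'}$; it depends only on $\tilde d$ and determines $\tilde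 d$, so $\widetilde{Ord}(\Pi_1)$ is identified with a set of partial orders on $\Pi_1$. The lifting $\tilde{od}$ of $\tilde d$ is the partial order on $\Pi$ generated (by transitive closure) by $\le_{\tilde d}$ together with the relations $\alpha<\beta$ for all edges $\overline{\alpha\beta}$ with $\alpha\in\Pi_1,\beta\in\Pi_2$ (its Hasse diagram is the reduction of the union of the oriented graphs $o_{\Pi_1,\Pi_2}$ and $\tilde d$). -}

module Defs where

open import Level using (0ℓ)
open import Data.Nat using (ℕ)
open import Data.Fin using (Fin)
open import Data.Bool using (Bool; true; false)
open import Data.Unit using (⊤)
open import Data.Empty using (⊥)
open import Data.Product using (Σ; ∃; _×_; _,_)
open import Data.Sum using (_⊎_)
open import Relation.Nullary using (¬_)
open import Relation.Binary.Core using (Rel)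
open import Relation.Binary.PropositionalEquality using (_≡_; _≢_)
open import Relation.Binary.Construct.Closure.ReflexiveTransitive using (Star)
open import Relation.Binary.Construct.Closure.Transitive using (TransClosure)

module _ {n : ℕ} where

  IsPartialOrderOn : (S : Fin n → Set) → Rel (Fin n) 0ℓ → Set
  IsPartialOrderOn S R =
    (∀ x y → R x y → S x × S y) ×
    (∀ x → S x → R x x) ×
    (∀ x y → R x y → R y x → x ≡ y) ×
    (∀ x y z → R x y → R y z → R x z)

  IsLinearOrderOn : (S : Fin n → Set) → Rel (Fin n) 0ℓ → Set
  IsLinearOrderOn S R =
    IsPartialOrderOn S R × (∀ x y → S x → S y → R x y ⊎ R y x)

  Strict : Rel (Fin n) 0ℓ → Rel (Fin n) 0ℓ
  Strict R x y = R x y × x ≢ y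

  _⊑_ : Rel (Fin n) 0ℓ → Rel (Fin n) 0ℓ → Set
  f ⊑ e = ∀ x y → Strict f x y → Strict e x y

  _≐_ : Rel (Fin n) 0ℓ → Rel (Fin n) 0ℓ → Set
  R ≐ R' = ∀ x y → (R x y → R' x y) × (R' x y → R x y)

  Extends : Rel (Fin n) 0ℓ → Rel (Fin n) 0ℓ → Set
  Extends c p = ∀ x y → p x y → Strict c x y

  -- c ∈ Σ(p) for a linear ordering c of S and a relation p (strict order
  -- or oriented graph, taken through its transitive closure)
  InΣ : (S : Fin n → Set) → Rel (Fin n) 0ℓ → Rel (Fin n) 0ℓ → Set
  InΣ S p c = IsLinearOrderOn S c × Extends c (TransClosure p)

  Minimal : (S : Fin n → Set) → Rel (Fin n) 0ℓ → Fin n → Set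
  Minimal S R x = S x × (∀ y → Strict R y x → ⊥)

  ImmPred : Rel (Fin n) 0ℓ → Fin n → Fin n → Set
  ImmPred R y x = Strict R y x × (∀ z → Strict R y z → Strict R z x → ⊥)

  IsRootedTree : (S : Fin n → Set) → Rel (Fin n) 0ℓ → Set
  IsRootedTree S R = Σ (Fin n) λ r →
    Minimal S R r ×
    (∀ x → Minimal S R x → x ≡ r) ×
    (∀ x → S x → x ≢ r →
       Σ (Fin n) λ y → ImmPred R y x × (∀ y' → ImmPred R y' x → y' ≡ y))

  Everything : Fin n → Set
  Everything _ = ⊤

  RemoveEdge : Rel (Fin n) 0ℓ → Fin n → Fin n → Rel (Fin n) 0ℓ
  RemoveEdge E x y a b = E a b × ¬ (a ≡ x × b ≡ y) × ¬ (a ≡ y × b ≡ x)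

  IsTree : Rel (Fin n) 0ℓ → Set
  IsTree E =
    (∀ x y → E x y → E y x) ×
    (∀ x → ¬ E x x) ×
    (∀ x y → Star E x y) ×
    (∀ x y → E x y → ¬ Star (RemoveEdge E x y) x y)

  In₁ : (Fin n → Bool) → Fin n → Set
  In₁ π₁ x = π₁ x ≡ true

  In₂ : (Fin n → Bool) → Fin n → Set
  In₂ π₁ x = π₁ x ≡ false

  IsPrincipalDecomposition : Rel (Fin n) 0ℓ → (Fin n → Bool) → Set
  IsPrincipalDecomposition E π₁ = ∀ x y → E x y → π₁ x ≢ π₁ y

  PrincOrient : Rel (Fin n) 0ℓ → (Fin n → Bool) → Rel (Fin n) 0ℓ
  PrincOrient E π₁ x y = E x y × In₁ π₁ x × In₂ π₁ y

  Nbd : Rel (Fin n) 0ℓ → Fin n → Fin n → Set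
  Nbd E β u = E β u

  module _ (E : Rel (Fin n) 0ℓ) (π₁ : Fin n → Bool) where

    -- u ∈ Γ_{d,v}: u is connected to v in the subgraph induced on
    -- Π ∖ {w ∈ Π₁ | w <_d v}
    Allowed : Rel (Fin n) 0ℓ → Fin n → Fin n → Set
    Allowed d v w = ¬ (In₁ π₁ w × Strict d w v)

    InΓ : Rel (Fin n) 0ℓ → Fin n → Fin n → Set
    InΓ d v u =
      Star (λ a b → E a b × Allowed d v a × Allowed d v b) v u

    OrdRel : Rel (Fin n) 0ℓ → Rel (Fin n) 0ℓ
    OrdRel d v' v = In₁ π₁ v' × In₁ π₁ v × InΓ d v' v

    IsOrdTilde : Rel (Fin n) 0ℓ → Set₁
    IsOrdTilde R = Σ (Rel (Fin n) 0ℓ) λ d →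
      IsLinearOrderOn (In₁ π₁) d × (R ≐ OrdRel d)

    NbdTotal : Rel (Fin n) 0ℓ → Set
    NbdTotal R = ∀ β → In₂ π₁ β → ∀ u v → Nbd E β u → Nbd E β v →
      R u v ⊎ R v u

    Cond₁₂ : Rel (Fin n) 0ℓ → Set
    Cond₁₂ R = IsPartialOrderOn (In₁ π₁) R × IsRootedTree (In₁ π₁) R ×
               NbdTotal R

    Characterised : Rel (Fin n) 0ℓ → Set₁
    Characterised R = Cond₁₂ R ×
      (∀ f → Cond₁₂ f → f ⊑ R → f ≐ R)

    Cond₁₂₃ : Rel (Fin n) 0ℓ → Set
    Cond₁₂₃ e =
      IsPartialOrderOn Everything e × IsRootedTree Everything e ×
      (∀ α β → E α β → In₁ π₁ α → In₂ π₁ β → Strict e α β) ×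
      (∀ β β' → In₂ π₁ β → In₂ π₁ β' → β ≢ β' → ¬ e β β')

    IsOrdΠ : Rel (Fin n) 0ℓ → Set₁
    IsOrdΠ e = Cond₁₂₃ e × (∀ f → Cond₁₂₃ f → f ⊑ e → f ≐ e)

    Lift : Rel (Fin n) 0ℓ → Rel (Fin n) 0ℓ
    Lift d = Star (λ x y → d x y ⊎ PrincOrient E π₁ x y)

{-# OPTIONS --safe #-}
module Submission where

-- Let d be a linear ordering of Π₁ and write v′ ≤ᵈ v for v ∈ Γ_{d,v′}. Then ≤ᵈ lies inside d,
-- is a rooted tree, is total on every Nbd(β), and its lower sets are chains. Conversely, any
-- partial order f on Π₁ with the last two properties that lies inside d contains ≤ᵈ: going
-- back along a path of Γ_{d,v} from u to v, every step passes through some β ∈ Π₂ whose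
-- neighbours are f-comparable, and u <_f v is impossible because u <_d v would have removed u
-- from Γ_{d,v}. Rooted trees have chain lower sets and, being decidable, linear extensions, so
-- this minimality of ≤ᵈ gives part 1. In the same way the lifting of ≤ᵈ is contained in every
-- ẽ satisfying (i)-(iii) of part 2 whose restriction to Π₁ lies inside d, so a minimal ẽ is the
-- lifting of ≤ᵈ for every linear d extending ẽ on Π₁. Taking for d a linear extension of ẽ,
-- or the restriction to Π₁ of some c ∈ Σ(o) or c ∈ Σ(ẽ), gives parts 2 and 3.

open import Defs
open import Level using (0ℓ)
open import Data.Bool using (Bool; true; false)
import Data.Bool.Properties as Bool
open import Data.Empty using (⊥-elim)
open import Data.Fin as Fin using (Fin; zero; suc)
open import Data.Fin.Properties using (_≟_; any?; pigeonhole)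
import Data.Fin.Properties as Fin
open import Data.Fin.Induction using (spo-wellFounded; spo-noetherian)
open import Data.Fin.Subset using (Subset; _∈_; ∣_∣)
open import Data.Fin.Subset.Properties using (p⊂q⇒∣p∣<∣q∣)
open import Data.List using (List; []; _∷_; length; lookup)
open import Data.List.Membership.Propositional.Properties using (∈-lookup)
open import Data.List.Relation.Unary.All as All using (All; []; _∷_)
open import Data.List.Relation.Unary.AllPairs using ([]; _∷_)
open import Data.List.Relation.Unary.Unique.Propositional using (Unique)
open import Data.Nat as ℕ using (ℕ; zero; suc; s≤s)
import Data.Nat.Properties as ℕ
open import Data.Product using (Σ; ∃; _×_; _,_; proj₁; proj₂; swap; map₁)
open import Data.Product.Relation.Binary.Lex.NonStrict using (×-Lex; ×-isTotalOrder)
open import Data.Sum as Sum using (_⊎_; inj₁; inj₂)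
open import Data.Unit using (tt)
open import Data.Vec using (tabulate)
open import Data.Vec.Properties using (lookup∘tabulate; lookup⇒[]=; []=⇒lookup)
open import Function using (_∘_; flip; id)
open import Function.Bundles using (_⇔_; mk⇔)
open import Induction.WellFounded using (WellFounded; Acc; acc)
open import Relation.Binary.Core using (Rel; _⇒_)
open import Relation.Binary.Definitions using (Decidable)
open import Relation.Binary.Structures using (IsStrictPartialOrder; IsTotalOrder)
import Relation.Binary.Construct.Flip.EqAndOrd as Flip
open import Relation.Binary.Construct.Closure.ReflexiveTransitive using (Star; ε; _◅_; _◅◅_)
import Relation.Binary.Construct.Closure.ReflexiveTransitive as Star
open import Relation.Binary.Construct.Closure.Transitive using (TransClosure; [_]; _∷_)
open import Relation.Binary.PropositionalEquality
open import Relation.Nullary using (yes; no; ¬_; does)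
open import Relation.Nullary.Decidable
  using (_×-dec_; _⊎-dec_; ¬?; map′; dec-true; decidable-stable; ¬¬-excluded-middle)
open import Relation.Nullary.Negation using (¬¬-map)
open import Relation.Unary using (Pred) renaming (Decidable to Decidable₁)

module _ {n : ℕ} where

  LowerSetsTotal : Rel (Fin n) 0ℓ → Set
  LowerSetsTotal _≤_ = ∀ {x y z} → x ≤ z → y ≤ z → x ≤ y ⊎ y ≤ x

  Restrict : Pred (Fin n) 0ℓ → Rel (Fin n) 0ℓ → Rel (Fin n) 0ℓ
  Restrict T R x y = R x y × T x × T y

  mk≐ : {R R′ : Rel (Fin n) 0ℓ} → R ⇒ R′ → R′ ⇒ R → R ≐ R′
  mk≐ to from _ _ = to , from

  ≐⇒⇒ : {R R′ : Rel (Fin n) 0ℓ} → R ≐ R′ → R ⇒ R′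
  ≐⇒⇒ R≐R′ = proj₁ (R≐R′ _ _)

  ≐-refl : {R : Rel (Fin n) 0ℓ} → R ≐ R
  ≐-refl = mk≐ id id

  ≐-sym : {R R′ : Rel (Fin n) 0ℓ} → R ≐ R′ → R′ ≐ R
  ≐-sym R≐R′ x y = swap (R≐R′ x y)

  ≐-trans : {R R′ R″ : Rel (Fin n) 0ℓ} → R ≐ R′ → R′ ≐ R″ → R ≐ R″
  ≐-trans R≐R′ R′≐R″ =
    mk≐ (≐⇒⇒ R′≐R″ ∘ ≐⇒⇒ R≐R′) (≐⇒⇒ (≐-sym R≐R′) ∘ ≐⇒⇒ (≐-sym R′≐R″))

  ⇒⇒⊑ : {R R′ : Rel (Fin n) 0ℓ} → R ⇒ R′ → R ⊑ R′
  ⇒⇒⊑ R⇒R′ _ _ (xRy , x≢y) = R⇒R′ xRy , x≢y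

  strict-resp-≐ : {R R′ : Rel (Fin n) 0ℓ} → R ≐ R′ → Strict R ⇒ Strict R′
  strict-resp-≐ R≐R′ = map₁ (≐⇒⇒ R≐R′)

  ⊑-resp-≐ : {R R′ f : Rel (Fin n) 0ℓ} → R ≐ R′ → f ⊑ R′ → f ⊑ R
  ⊑-resp-≐ R≐R′ f⊑R′ x y = strict-resp-≐ (≐-sym R≐R′) ∘ f⊑R′ x y

  partialOrder-resp-≐ : {R R′ : Rel (Fin n) 0ℓ} {S : Pred (Fin n) 0ℓ} →
                        R ≐ R′ → IsPartialOrderOn S R → IsPartialOrderOn S R′
  partialOrder-resp-≐ {R} {R′} R≐R′ (dom , refl′ , antisym , trans′) =
    (λ x y → dom x y ∘ from) , (λ x → to ∘ refl′ x) ,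
    (λ x y xR′y yR′x → antisym x y (from xR′y) (from yR′x)) ,
    λ x y z xR′y yR′z → to (trans′ x y z (from xR′y) (from yR′z))
    where
    to : R ⇒ R′
    to = ≐⇒⇒ R≐R′
    from : R′ ⇒ R
    from = ≐⇒⇒ (≐-sym R≐R′)

  immPred-resp-≐ : {R R′ : Rel (Fin n) 0ℓ} → R ≐ R′ → ∀ {y x} → ImmPred R y x → ImmPred R′ y x
  immPred-resp-≐ R≐R′ (y<x , immediate) =
    strict-resp-≐ R≐R′ y<x ,
    λ z y<z z<x → immediate z (strict-resp-≐ (≐-sym R≐R′) y<z) (strict-resp-≐ (≐-sym R≐R′) z<x)

  rootedTree-resp-≐ : {R R′ : Rel (Fin n) 0ℓ} {S : Pred (Fin n) 0ℓ} →
                      R ≐ R′ → IsRootedTree S R → IsRootedTree S R′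
  rootedTree-resp-≐ R≐R′ (r , (Sr , r-minimal) , root-unique , parent) =
    r , (Sr , λ y → r-minimal y ∘ strict-resp-≐ (≐-sym R≐R′)) ,
    (λ x (Sx , x-minimal) → root-unique x (Sx , λ y → x-minimal y ∘ strict-resp-≐ R≐R′)) ,
    λ x Sx x≢r → let y , y-immediate , y-unique = parent x Sx x≢r in
      y , immPred-resp-≐ R≐R′ y-immediate , λ y′ → y-unique y′ ∘ immPred-resp-≐ (≐-sym R≐R′)

  ¬¬-decidable : (R : Rel (Fin n) 0ℓ) → ¬ ¬ Decidable R
  ¬¬-decidable R = ¬¬-Π λ _ → ¬¬-Π λ _ → ¬¬-excluded-middle
    where
    ¬¬-Π : ∀ {m} {P : Fin m → Set} → (∀ i → ¬ ¬ P i) → ¬ ¬ (∀ i → P i)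
    ¬¬-Π {zero} _ k = k λ ()
    ¬¬-Π {suc m} ¬¬P k = ¬¬P zero λ P₀ → ¬¬-Π (¬¬P ∘ suc) λ Pₛ → k λ { zero → P₀ ; (suc i) → Pₛ i }

module _ {n : ℕ} {_<_ : Rel (Fin n) 0ℓ} (<-spo : IsStrictPartialOrder _≡_ _<_) (_<?_ : Decidable _<_) where

  maximal : ∀ {Q : Pred (Fin n) 0ℓ} → Decidable₁ Q → ∃ Q → ∃ λ m → Q m × (∀ z → Q z → ¬ m < z)
  maximal {Q} Q? (x , Qx) = climb (spo-noetherian <-spo x) Qx
    where
    climb : ∀ {m} → Acc (flip _<_) m → Q m → ∃ λ m → Q m × (∀ z → Q z → ¬ m < z)
    climb {m} (acc higher) Qm with any? (λ z → Q? z ×-dec m <? z)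
    ... | yes (z , Qz , m<z) = climb (higher m<z) Qz
    ... | no none = m , Qm , λ z Qz m<z → none (z , Qz , m<z)

minimal : ∀ {n} {_<_ : Rel (Fin n) 0ℓ} → IsStrictPartialOrder _≡_ _<_ → Decidable _<_ →
          ∀ {Q : Pred (Fin n) 0ℓ} → Decidable₁ Q → ∃ Q → ∃ λ m → Q m × (∀ z → Q z → ¬ z < m)
minimal <-spo _<?_ = maximal (Flip.isStrictPartialOrder <-spo) (flip _<?_)

module PartialOrderOn {n : ℕ} {S : Pred (Fin n) 0ℓ} {_≤_ : Rel (Fin n) 0ℓ}
                      (po : IsPartialOrderOn S _≤_) where

  ≤-dom : ∀ {x y} → x ≤ y → S x × S y
  ≤-dom = proj₁ po _ _

  ≤-refl : ∀ {x} → S x → x ≤ x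
  ≤-refl = proj₁ (proj₂ po) _

  ≤-antisym : ∀ {x y} → x ≤ y → y ≤ x → x ≡ y
  ≤-antisym = proj₁ (proj₂ (proj₂ po)) _ _

  ≤-trans : ∀ {x y z} → x ≤ y → y ≤ z → x ≤ z
  ≤-trans = proj₂ (proj₂ (proj₂ po)) _ _ _

  <⇒≱ : ∀ {x y} → Strict _≤_ x y → ¬ y ≤ x
  <⇒≱ (x≤y , x≢y) y≤x = x≢y (≤-antisym x≤y y≤x)

  ≤-<-trans : ∀ {x y z} → x ≤ y → Strict _≤_ y z → Strict _≤_ x z
  ≤-<-trans x≤y (y≤z , y≢z) = ≤-trans x≤y y≤z , λ { refl → y≢z (≤-antisym y≤z x≤y) }

  <-≤-trans : ∀ {x y z} → Strict _≤_ x y → y ≤ z → Strict _≤_ x z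
  <-≤-trans (x≤y , x≢y) y≤z = ≤-trans x≤y y≤z , λ { refl → x≢y (≤-antisym x≤y y≤z) }

  <-isStrictPartialOrder : IsStrictPartialOrder _≡_ (Strict _≤_)
  <-isStrictPartialOrder = record
    { isEquivalence = isEquivalence
    ; irrefl = λ { refl (_ , x≢x) → x≢x refl }
    ; trans = λ x<y → ≤-<-trans (proj₁ x<y)
    ; <-resp-≈ = resp₂ (Strict _≤_)
    }

  <-wellFounded : WellFounded (Strict _≤_)
  <-wellFounded = spo-wellFounded <-isStrictPartialOrder

  <-dec : Decidable _≤_ → Decidable (Strict _≤_)
  <-dec _≤?_ x y = x ≤? y ×-dec ¬? (x ≟ y)

  total⇒dec : Decidable₁ S → (∀ x y → S x → S y → x ≤ y ⊎ y ≤ x) → Decidable _≤_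
  total⇒dec S? total x y with S? x | S? y
  ... | no ¬Sx | _ = no (¬Sx ∘ proj₁ ∘ ≤-dom)
  ... | yes _ | no ¬Sy = no (¬Sy ∘ proj₂ ∘ ≤-dom)
  ... | yes Sx | yes Sy with total x y Sx Sy | x ≟ y
  ...   | inj₁ x≤y | _ = yes x≤y
  ...   | inj₂ y≤x | yes refl = yes y≤x
  ...   | inj₂ y≤x | no x≢y = no λ x≤y → x≢y (≤-antisym x≤y y≤x)

  ⊑⇒⇒ : ∀ {R} → IsPartialOrderOn S R → R ⊑ _≤_ → R ⇒ _≤_
  ⊑⇒⇒ R-po R⊑≤ {x} {y} xRy with x ≟ y
  ... | yes refl = ≤-refl (proj₁ (proj₁ R-po x y xRy))
  ... | no x≢y = proj₁ (R⊑≤ x y (xRy , x≢y))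

  strict-closure : ∀ {p} → (∀ x y → p x y → Strict _≤_ x y) → Extends _≤_ (TransClosure p)
  strict-closure p⊆< x y [ xpy ] = p⊆< x y xpy
  strict-closure p⊆< x y (xpz ∷ zp⁺y) = ≤-<-trans (proj₁ (p⊆< x _ xpz)) (strict-closure p⊆< _ y zp⁺y)

  rootedTree : Decidable _≤_ → ∀ r → S r → (∀ {x} → S x → r ≤ x) → LowerSetsTotal _≤_ →
               IsRootedTree S _≤_
  rootedTree _≤?_ r Sr r≤ chains =
    r , (Sr , λ y y<r → <⇒≱ y<r (r≤ (proj₁ (≤-dom (proj₁ y<r))))) , root-unique , parent
    where
    root-unique : ∀ x → Minimal S _≤_ x → x ≡ r
    root-unique x (Sx , x-minimal) with x ≟ r
    ... | yes x≡r = x≡r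
    ... | no x≢r = ⊥-elim (x-minimal r (r≤ Sx , x≢r ∘ sym))
    parent : ∀ x → S x → x ≢ r → Σ (Fin n) λ y → ImmPred _≤_ y x × (∀ y′ → ImmPred _≤_ y′ x → y′ ≡ y)
    parent x Sx x≢r with maximal <-isStrictPartialOrder (<-dec _≤?_) (λ y → <-dec _≤?_ y x)
                                 (r , r≤ Sx , x≢r ∘ sym)
    ... | m , m<x , m-maximal = m , (m<x , λ z m<z z<x → m-maximal z z<x m<z) , unique
      where
      unique : ∀ y → ImmPred _≤_ y x → y ≡ m
      unique y (y<x , y-immediate) with y ≟ m | chains (proj₁ y<x) (proj₁ m<x)
      ... | yes y≡m | _ = y≡m
      ... | no y≢m | inj₁ y≤m = ⊥-elim (y-immediate m (y≤m , y≢m) m<x)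
      ... | no y≢m | inj₂ m≤y = ⊥-elim (m-maximal y y<x (m≤y , y≢m ∘ sym))

module _ {n : ℕ} {T : Pred (Fin n) 0ℓ} {R : Rel (Fin n) 0ℓ} where

  restrict-partialOrder : IsPartialOrderOn Everything R → IsPartialOrderOn T (Restrict T R)
  restrict-partialOrder po =
    (λ _ _ → proj₂) , (λ _ Tx → ≤-refl tt , Tx , Tx) ,
    (λ _ _ xRy yRx → ≤-antisym (proj₁ xRy) (proj₁ yRx)) ,
    λ _ _ _ (xRy , Tx , _) (yRz , _ , Tz) → ≤-trans xRy yRz , Tx , Tz
    where open PartialOrderOn po

  restrict-linear : IsLinearOrderOn Everything R → IsLinearOrderOn T (Restrict T R)
  restrict-linear (po , total) =
    restrict-partialOrder po ,
    λ x y Tx Ty → Sum.map (_, Tx , Ty) (_, Ty , Tx) (total x y tt tt)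

extends⇒⊇ : ∀ {n} {R e : Rel (Fin n) 0ℓ} → IsPartialOrderOn Everything R →
            Extends R (TransClosure (Strict e)) → e ⇒ R
extends⇒⊇ po extends {x} {y} xey with x ≟ y
... | yes refl = PartialOrderOn.≤-refl po tt
... | no x≢y = proj₁ (extends x y [ xey , x≢y ])

pullback-linear : ∀ {n} {S : Pred (Fin n) 0ℓ} {A : Set} {_≈_ _⊴_ : Rel A 0ℓ} →
                  IsTotalOrder _≈_ _⊴_ → (key : Fin n → A) → (∀ {x y} → key x ≈ key y → x ≡ y) →
                  IsLinearOrderOn S (Restrict S (λ x y → key x ⊴ key y))
pullback-linear tot key key-injective =
  ((λ _ _ → proj₂) , (λ _ Sx → refl′ , Sx , Sx) ,
   (λ _ _ x⊴y y⊴x → key-injective (antisym (proj₁ x⊴y) (proj₁ y⊴x))) ,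
   λ _ _ _ (x⊴y , Sx , _) (y⊴z , _ , Sz) → trans′ x⊴y y⊴z , Sx , Sz) ,
  λ x y Sx Sy → Sum.map (_, Sx , Sy) (_, Sy , Sx) (total (key x) (key y))
  where
  open IsTotalOrder tot renaming (refl to refl′; trans to trans′)

module LinearExtension {n : ℕ} {S : Pred (Fin n) 0ℓ} {_≤_ : Rel (Fin n) 0ℓ}
                       (po : IsPartialOrderOn S _≤_) (_≤?_ : Decidable _≤_) where
  open PartialOrderOn po

  downSet : Fin n → Subset n
  downSet x = tabulate λ z → does (z ≤? x)

  ∈-downSet⁺ : ∀ {z x} → z ≤ x → z ∈ downSet x
  ∈-downSet⁺ {z} {x} z≤x = lookup⇒[]= z (downSet x) (trans (lookup∘tabulate _ z) (dec-true (z ≤? x) z≤x))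

  ∈-downSet⁻ : ∀ {z x} → z ∈ downSet x → z ≤ x
  ∈-downSet⁻ {z} {x} z∈ with z ≤? x | trans (sym (lookup∘tabulate (λ z → does (z ≤? x)) z)) ([]=⇒lookup z∈)
  ... | yes z≤x | _ = z≤x
  ... | no _ | ()

  rank : Fin n → ℕ
  rank x = ∣ downSet x ∣

  rank-mono : ∀ {x y} → Strict _≤_ x y → rank x ℕ.< rank y
  rank-mono (x≤y , x≢y) =
    p⊂q⇒∣p∣<∣q∣ ( (λ z∈ → ∈-downSet⁺ (≤-trans (∈-downSet⁻ z∈) x≤y))
                , _ , ∈-downSet⁺ (≤-refl (proj₂ (≤-dom x≤y)))
                , λ y∈ → x≢y (≤-antisym x≤y (∈-downSet⁻ y∈)) )

  _⊴_ : Rel (Fin n) 0ℓ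
  _⊴_ = Restrict S λ x y → ×-Lex _≡_ ℕ._≤_ Fin._≤_ (rank x , x) (rank y , y)

  ⊴-linear : IsLinearOrderOn S _⊴_
  ⊴-linear = pullback-linear (×-isTotalOrder ℕ._≟_ ℕ.≤-isTotalOrder Fin.≤-isTotalOrder) _ proj₂

  ≤⇒⊴ : _≤_ ⇒ _⊴_
  ≤⇒⊴ {x} {y} x≤y with x ≟ y | ≤-dom x≤y
  ... | yes refl | Sx , _ = inj₂ (refl , Fin.≤-refl) , Sx , Sx
  ... | no x≢y | Sx , Sy = inj₁ (ℕ.<⇒≤ rank< , ℕ.<⇒≢ rank<) , Sx , Sy
    where
    rank< : rank x ℕ.< rank y
    rank< = rank-mono (x≤y , x≢y)

module Walks {n : ℕ} {G : Rel (Fin n) 0ℓ} where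

  vertices : ∀ {a b} → Star G a b → List (Fin n)
  vertices {a} ε = a ∷ []
  vertices {a} (_ ◅ w) = a ∷ vertices w

  All-first : ∀ {P : Pred (Fin n) 0ℓ} {a b} (w : Star G a b) → All P (vertices w) → P a
  All-first ε (Pa ∷ _) = Pa
  All-first (_ ◅ _) (Pa ∷ _) = Pa

  All-last : ∀ {P : Pred (Fin n) 0ℓ} {a b} (w : Star G a b) → All P (vertices w) → P b
  All-last ε (Pb ∷ []) = Pb
  All-last (_ ◅ w) (_ ∷ Pw) = All-last w Pw

  Path : Rel (Fin n) 0ℓ
  Path a b = Σ (Star G a b) (Unique ∘ vertices)

  suffix-from : ∀ x {a b} (w : Star G a b) → Unique (vertices w) → Path x b ⊎ All (x ≢_) (vertices w)
  suffix-from x {a} ε u with x ≟ a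
  ... | yes refl = inj₁ (ε , u)
  ... | no x≢a = inj₂ (x≢a ∷ [])
  suffix-from x {a} (g ◅ w) (a∉w ∷ u) with x ≟ a
  ... | yes refl = inj₁ (g ◅ w , a∉w ∷ u)
  ... | no x≢a = Sum.map₂ (x≢a ∷_) (suffix-from x w u)

  walk⇒path : Star G ⇒ Path
  walk⇒path ε = ε , [] ∷ []
  walk⇒path {a} (g ◅ w) with walk⇒path w
  ... | p , u with suffix-from a p u
  ...   | inj₁ shortcut = shortcut
  ...   | inj₂ a∉p = g ◅ p , a∉p ∷ u

  unique-length : ∀ {xs : List (Fin n)} → Unique xs → length xs ℕ.≤ n
  unique-length {xs} u with length xs ℕ.≤? n
  ... | yes ≤n = ≤n
  ... | no ≰n with pigeonhole (ℕ.≰⇒> ≰n) (lookup xs)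
  ...   | i , j , i<j , xsᵢ≡xsⱼ = ⊥-elim (lookup-injective u i<j xsᵢ≡xsⱼ)
    where
    lookup-injective : ∀ {xs : List (Fin n)} → Unique xs → ∀ {i j} → i Fin.< j → lookup xs i ≢ lookup xs j
    lookup-injective (x∉xs ∷ _) {zero} {suc j} _ = All.lookup x∉xs (∈-lookup j)
    lookup-injective (_ ∷ u) {suc i} {suc j} (s≤s i<j) = lookup-injective u i<j

  Reach : ℕ → Rel (Fin n) 0ℓ
  Reach zero a b = a ≡ b
  Reach (suc k) a b = a ≡ b ⊎ ∃ λ c → G a c × Reach k c b

  Reach-dec : Decidable G → ∀ k → Decidable (Reach k)
  Reach-dec G? zero a b = a ≟ b
  Reach-dec G? (suc k) a b = a ≟ b ⊎-dec any? λ c → G? a c ×-dec Reach-dec G? k c b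

  Reach⇒Star : ∀ k → Reach k ⇒ Star G
  Reach⇒Star zero refl = ε
  Reach⇒Star (suc k) (inj₁ refl) = ε
  Reach⇒Star (suc k) (inj₂ (_ , g , r)) = g ◅ Reach⇒Star k r

  short⇒Reach : ∀ k {a b} (w : Star G a b) → length (vertices w) ℕ.≤ suc k → Reach k a b
  short⇒Reach zero ε _ = refl
  short⇒Reach zero (_ ◅ ε) (s≤s ())
  short⇒Reach zero (_ ◅ _ ◅ _) (s≤s ())
  short⇒Reach (suc k) ε _ = inj₁ refl
  short⇒Reach (suc k) (g ◅ w) (s≤s ≤k) = inj₂ (_ , g , short⇒Reach k w ≤k)

  Star-dec : Decidable G → Decidable (Star G)
  Star-dec G? a b = map′ (Reach⇒Star n) reach (Reach-dec G? n a b)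
    where
    reach : Star G a b → Reach n a b
    reach w = short⇒Reach n (proj₁ (walk⇒path w)) (ℕ.m≤n⇒m≤1+n (unique-length (proj₂ (walk⇒path w))))

  deterministic⇒comparable : (∀ {a b b′} → G a b → G a b′ → b ≡ b′) →
                             ∀ {z x y} → Star G z x → Star G z y → Star G x y ⊎ Star G y x
  deterministic⇒comparable det ε w = inj₁ w
  deterministic⇒comparable det (g ◅ v) ε = inj₂ (g ◅ v)
  deterministic⇒comparable det (g ◅ v) (g′ ◅ w) with det g g′
  ... | refl = deterministic⇒comparable det v w

open Walks using (Star-dec; deterministic⇒comparable)

module RootedTree {n : ℕ} {S : Pred (Fin n) 0ℓ} (S? : Decidable₁ S) {_≤_ : Rel (Fin n) 0ℓ}
                  (po : IsPartialOrderOn S _≤_) (rt : IsRootedTree S _≤_) where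
  open PartialOrderOn po

  root : Fin n
  root = proj₁ rt

  -- junk value: parent x = x at the root and outside S
  parent : Fin n → Fin n
  parent x with S? x | x ≟ root
  ... | yes Sx | no x≢root = proj₁ (proj₂ (proj₂ (proj₂ rt)) x Sx x≢root)
  ... | _ | _ = x

  parent-spec : ∀ {x} → S x → x ≢ root →
                ImmPred _≤_ (parent x) x × (∀ y → ImmPred _≤_ y x → y ≡ parent x)
  parent-spec {x} Sx x≢root with S? x | x ≟ root
  ... | yes Sx′ | no x≢root′ = proj₂ (proj₂ (proj₂ (proj₂ rt)) x Sx′ x≢root′)
  ... | no ¬Sx | _ = ⊥-elim (¬Sx Sx)
  ... | yes _ | yes x≡root = ⊥-elim (x≢root x≡root)

  ParentOf : Rel (Fin n) 0ℓ
  ParentOf x y = S x × x ≢ root × y ≡ parent x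

  ParentOf-dec : Decidable ParentOf
  ParentOf-dec x y = S? x ×-dec ¬? (x ≟ root) ×-dec y ≟ parent x

  ParentOf-deterministic : ∀ {x y y′} → ParentOf x y → ParentOf x y′ → y ≡ y′
  ParentOf-deterministic (_ , _ , refl) (_ , _ , refl) = refl

  parent-< : ∀ {x y} → ParentOf x y → Strict _≤_ y x
  parent-< (Sx , x≢root , refl) = proj₁ (proj₁ (parent-spec Sx x≢root))

  ancestor⇒≤ : ∀ {x y} → Star ParentOf y x → S y → x ≤ y
  ancestor⇒≤ ε Sy = ≤-refl Sy
  ancestor⇒≤ (step ◅ w) _ with parent-< step
  ... | p≤y , _ = ≤-trans (ancestor⇒≤ w (proj₁ (≤-dom p≤y))) p≤y

  dec⇒≤⇒ancestor : Decidable _≤_ → ∀ {x y} → x ≤ y → Star ParentOf y x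
  dec⇒≤⇒ancestor _≤?_ = descend (<-wellFounded _)
    where
    descend : ∀ {x y} → Acc (Strict _≤_) y → x ≤ y → Star ParentOf y x
    descend {x} {y} (acc lower) x≤y with x ≟ y
    ... | yes refl = ε
    ... | no x≢y with maximal <-isStrictPartialOrder (<-dec _≤?_)
                                (λ z → x ≤? z ×-dec <-dec _≤?_ z y)
                                (x , ≤-refl (proj₁ (≤-dom x≤y)) , x≤y , x≢y)
    ...   | z , (x≤z , z<y) , z-maximal =
      step ◅ descend (lower (parent-< step)) (subst (x ≤_) z≡parent x≤z)
      where
      Sy : S y
      Sy = proj₂ (≤-dom x≤y)
      y≢root : y ≢ root
      y≢root refl = proj₂ (proj₁ (proj₂ rt)) x (x≤y , x≢y)
      step : ParentOf y (parent y)
      step = Sy , y≢root , refl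
      z≡parent : z ≡ parent y
      z≡parent = proj₂ (parent-spec Sy y≢root) z
        (z<y , λ w z<w w<y → z-maximal w (≤-trans x≤z (proj₁ z<w) , w<y) z<w)

  -- Being an ancestor is decidable, so the decidability of _≤_ needed above may be
  -- assumed under a double negation.
  ≤⇒ancestor : ∀ {x y} → x ≤ y → Star ParentOf y x
  ≤⇒ancestor {x} {y} x≤y =
    decidable-stable (Star-dec ParentOf-dec y x)
      (¬¬-map (λ _≤?_ → dec⇒≤⇒ancestor _≤?_ x≤y) (¬¬-decidable _≤_))

  ≤-dec : Decidable _≤_
  ≤-dec x y = map′ (λ (Sy , w) → ancestor⇒≤ w Sy) (λ x≤y → proj₂ (≤-dom x≤y) , ≤⇒ancestor x≤y)
                   (S? y ×-dec Star-dec ParentOf-dec y x)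

  lowerSetsTotal : LowerSetsTotal _≤_
  lowerSetsTotal x≤z y≤z
    with deterministic⇒comparable ParentOf-deterministic (≤⇒ancestor x≤z) (≤⇒ancestor y≤z)
  ... | inj₁ x↝y = inj₂ (ancestor⇒≤ x↝y (proj₁ (≤-dom x≤z)))
  ... | inj₂ y↝x = inj₁ (ancestor⇒≤ y↝x (proj₁ (≤-dom y≤z)))

module PrincipalDecomposition {n : ℕ} (E : Rel (Fin n) 0ℓ) (π₁ : Fin n → Bool) (tree : IsTree E)
                              (principal : IsPrincipalDecomposition E π₁)
                              (Π₁-inhabited : Σ (Fin n) (In₁ π₁)) where

  Π₁ Π₂ : Pred (Fin n) 0ℓ
  Π₁ = In₁ π₁
  Π₂ = In₂ π₁

  E-sym : ∀ {x y} → E x y → E y x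
  E-sym = proj₁ tree _ _

  connected : ∀ x y → Star E x y
  connected = proj₁ (proj₂ (proj₂ tree))

  Π₁-dec : Decidable₁ Π₁
  Π₁-dec x = π₁ x Bool.≟ true

  Π₂-dec : Decidable₁ Π₂
  Π₂-dec x = π₁ x Bool.≟ false

  side : ∀ x → Π₁ x ⊎ Π₂ x
  side x with π₁ x
  ... | true = inj₁ refl
  ... | false = inj₂ refl

  Π₁⇒¬Π₂ : ∀ {x} → Π₁ x → ¬ Π₂ x
  Π₁⇒¬Π₂ x₁ x₂ with () ← trans (sym x₁) x₂

  Π₁-Π₂-distinct : ∀ {x y} → Π₁ x → Π₂ y → x ≢ y
  Π₁-Π₂-distinct x₁ y₂ refl = Π₁⇒¬Π₂ x₁ y₂

  edge-from-Π₁ : ∀ {x y} → Π₁ x → E x y → Π₂ y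
  edge-from-Π₁ {x} {y} x₁ xy with side y
  ... | inj₁ y₁ = ⊥-elim (principal x y xy (trans x₁ (sym y₁)))
  ... | inj₂ y₂ = y₂

  edge-from-Π₂ : ∀ {x y} → Π₂ x → E x y → Π₁ y
  edge-from-Π₂ {x} {y} x₂ xy with side y
  ... | inj₁ y₁ = y₁
  ... | inj₂ y₂ = ⊥-elim (principal x y xy (trans x₂ (sym y₂)))

  Π₂-neighbour : ∀ {x} → Π₂ x → ∃ (E x)
  Π₂-neighbour {x} x₂ with connected x (proj₁ Π₁-inhabited)
  ... | ε = ⊥-elim (Π₁⇒¬Π₂ (proj₂ Π₁-inhabited) x₂)
  ... | xy ◅ _ = _ , xy

  avoiding : ∀ {x y a b} (w : Star E a b) → All (x ≢_) (Walks.vertices w) → Star (RemoveEdge E x y) a b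
  avoiding ε _ = ε
  avoiding (ac ◅ w) (x≢a ∷ x∉w) =
    (ac , (λ (a≡x , _) → x≢a (sym a≡x)) , λ (_ , c≡x) → Walks.All-first w x∉w (sym c≡x)) ◅ avoiding w x∉w

  -- The path from x to y in the tree is a single edge exactly when x and y are adjacent.
  E-dec : Decidable E
  E-dec x y with Walks.walk⇒path (connected x y)
  ... | ε , _ = no (proj₁ (proj₂ tree) x)
  ... | xy ◅ ε , _ = yes xy
  ... | xc ◅ cd ◅ w , (x∉ ∷ c∉ ∷ _) =
    no λ xy → proj₂ (proj₂ (proj₂ tree)) x y xy (first ◅ avoiding (cd ◅ w) x∉)
    where
    first : RemoveEdge E x y x _
    first = xc , (λ (_ , c≡y) → Walks.All-last w c∉ c≡y) , λ (_ , c≡x) → All.head x∉ (sym c≡x)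

  PrincOrient-dec : Decidable (PrincOrient E π₁)
  PrincOrient-dec x y = E-dec x y ×-dec Π₁-dec x ×-dec Π₂-dec y

  module OrderOf (D : Rel (Fin n) 0ℓ) (D-linear : IsLinearOrderOn Π₁ D) where
    module D = PartialOrderOn (proj₁ D-linear)

    D-total : ∀ x y → Π₁ x → Π₁ y → D x y ⊎ D y x
    D-total = proj₂ D-linear

    D-dec : Decidable D
    D-dec = D.total⇒dec Π₁-dec D-total

    _≤ᵈ_ : Rel (Fin n) 0ℓ
    _≤ᵈ_ = OrdRel E π₁ D

    -- Γ_{d,v} is the connected component of v in the graph Residual v.
    Residual : Fin n → Rel (Fin n) 0ℓ
    Residual v a b = E a b × Allowed E π₁ D v a × Allowed E π₁ D v b

    allowed-self : ∀ {v} → Allowed E π₁ D v v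
    allowed-self (_ , _ , v≢v) = v≢v refl

    allowed-Π₂ : ∀ {v w} → Π₂ w → Allowed E π₁ D v w
    allowed-Π₂ w₂ (w₁ , _) = Π₁⇒¬Π₂ w₁ w₂

    allowed-dec : ∀ v → Decidable₁ (Allowed E π₁ D v)
    allowed-dec v w = ¬? (Π₁-dec w ×-dec D.<-dec D-dec w v)

    residual-antitone : ∀ {x y} → D x y → Star (Residual y) ⇒ Star (Residual x)
    residual-antitone {x} {y} x≤y = Star.map λ (ab , a-ok , b-ok) → ab , shrink a-ok , shrink b-ok
      where
      shrink : ∀ {w} → Allowed E π₁ D y w → Allowed E π₁ D x w
      shrink w-ok (w₁ , w<x) = w-ok (w₁ , D.<-≤-trans w<x x≤y)

    residual-reverse : ∀ {v a b} → Star (Residual v) a b → Star (Residual v) b a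
    residual-reverse = Star.reverse λ (ab , a-ok , b-ok) → E-sym ab , b-ok , a-ok

    end-allowed : ∀ {v a b} → Star (Residual v) a b → Allowed E π₁ D v a → Allowed E π₁ D v b
    end-allowed ε a-ok = a-ok
    end-allowed ((_ , _ , c-ok) ◅ w) _ = end-allowed w c-ok

    ≤ᵈ⇒D : _≤ᵈ_ ⇒ D
    ≤ᵈ⇒D {x} {y} (x₁ , y₁ , w) with D-total x y x₁ y₁ | x ≟ y
    ... | inj₁ x≤y | _ = x≤y
    ... | inj₂ y≤x | yes refl = y≤x
    ... | inj₂ y≤x | no x≢y = ⊥-elim (end-allowed w allowed-self (y₁ , y≤x , x≢y ∘ sym))

    ≤ᵈ-partialOrder : IsPartialOrderOn Π₁ _≤ᵈ_
    ≤ᵈ-partialOrder =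
      (λ _ _ (x₁ , y₁ , _) → x₁ , y₁) , (λ _ x₁ → x₁ , x₁ , ε) ,
      (λ _ _ x≤y y≤x → D.≤-antisym (≤ᵈ⇒D x≤y) (≤ᵈ⇒D y≤x)) ,
      λ _ _ _ x≤y (_ , z₁ , w) → proj₁ x≤y , z₁ , proj₂ (proj₂ x≤y) ◅◅ residual-antitone (≤ᵈ⇒D x≤y) w

    ≤ᵈ-lowerSetsTotal : LowerSetsTotal _≤ᵈ_
    ≤ᵈ-lowerSetsTotal (a₁ , _ , a↝v) (b₁ , _ , b↝v) with D-total _ _ a₁ b₁
    ... | inj₁ a≤b = inj₁ (a₁ , b₁ , a↝v ◅◅ residual-reverse (residual-antitone a≤b b↝v))
    ... | inj₂ b≤a = inj₂ (b₁ , a₁ , b↝v ◅◅ residual-reverse (residual-antitone b≤a a↝v))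

    ≤ᵈ-dec : Decidable _≤ᵈ_
    ≤ᵈ-dec x y = Π₁-dec x ×-dec Π₁-dec y ×-dec Star-dec residual-dec x y
      where
      residual-dec : Decidable (Residual x)
      residual-dec a b = E-dec a b ×-dec allowed-dec x a ×-dec allowed-dec x b

    D-least : ∃ λ r → Π₁ r × (∀ z → Π₁ z → ¬ Strict D z r)
    D-least = minimal D.<-isStrictPartialOrder (D.<-dec D-dec) Π₁-dec Π₁-inhabited

    dRoot : Fin n
    dRoot = proj₁ D-least

    dRoot-least : ∀ {x} → Π₁ x → dRoot ≤ᵈ x
    dRoot-least x₁ = proj₁ (proj₂ D-least) , x₁ , Star.map (λ e → e , allowed _ , allowed _) (connected _ _)
      where
      allowed : ∀ w → Allowed E π₁ D dRoot w
      allowed w (w₁ , w<dRoot) = proj₂ (proj₂ D-least) w w₁ w<dRoot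

    ≤ᵈ-rootedTree : IsRootedTree Π₁ _≤ᵈ_
    ≤ᵈ-rootedTree = PartialOrderOn.rootedTree ≤ᵈ-partialOrder ≤ᵈ-dec dRoot (proj₁ (proj₂ D-least))
                      dRoot-least ≤ᵈ-lowerSetsTotal

    neighbours-≤ᵈ : ∀ {β u v} → Π₂ β → E β u → E β v → D u v → u ≤ᵈ v
    neighbours-≤ᵈ β₂ βu βv u≤v =
      edge-from-Π₂ β₂ βu , edge-from-Π₂ β₂ βv ,
      (E-sym βu , allowed-self , allowed-Π₂ β₂) ◅ (βv , allowed-Π₂ β₂ , λ (_ , v<u) → D.<⇒≱ v<u u≤v) ◅ ε

    ≤ᵈ-nbdTotal : NbdTotal E π₁ _≤ᵈ_
    ≤ᵈ-nbdTotal β β₂ u v βu βv =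
      Sum.map (neighbours-≤ᵈ β₂ βu βv) (neighbours-≤ᵈ β₂ βv βu)
        (D-total u v (edge-from-Π₂ β₂ βu) (edge-from-Π₂ β₂ βv))

    ≤ᵈ-cond₁₂ : Cond₁₂ E π₁ _≤ᵈ_
    ≤ᵈ-cond₁₂ = ≤ᵈ-partialOrder , ≤ᵈ-rootedTree , ≤ᵈ-nbdTotal

    ≤ᵈ-least : ∀ {f} → IsPartialOrderOn Π₁ f → LowerSetsTotal f → NbdTotal E π₁ f → f ⇒ D → _≤ᵈ_ ⇒ f
    ≤ᵈ-least {f} f-po f-chains f-nbd f⇒D (v₁ , u₁ , v↝u) = climb v₁ u₁ (residual-reverse v↝u)
      where
      open PartialOrderOn f-po
      climb : ∀ {v u} → Π₁ v → Π₁ u → Star (Residual v) u v → f v u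
      climb v₁ u₁ ε = ≤-refl v₁
      climb v₁ u₁ ((uβ , _) ◅ ε) = ⊥-elim (Π₁⇒¬Π₂ v₁ (edge-from-Π₁ u₁ uβ))
      climb {v} {u} v₁ u₁ ((uβ , u-ok , _) ◅ (βa , _) ◅ a↝v) with edge-from-Π₁ u₁ uβ
      ... | β₂ with climb v₁ (edge-from-Π₂ β₂ βa) a↝v | f-nbd _ β₂ _ _ βa (E-sym uβ)
      ...   | v≤a | inj₁ a≤u = ≤-trans v≤a a≤u
      ...   | v≤a | inj₂ u≤a with f-chains v≤a u≤a | u ≟ v
      ...     | inj₁ v≤u | _ = v≤u
      ...     | inj₂ _ | yes refl = ≤-refl v₁
      ...     | inj₂ u≤v | no u≢v = ⊥-elim (u-ok (u₁ , f⇒D u≤v , u≢v))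

    ≤ᵈ-characterised : Characterised E π₁ _≤ᵈ_
    ≤ᵈ-characterised = ≤ᵈ-cond₁₂ , λ f (f-po , f-rt , f-nbd) f⊑≤ᵈ →
      let f⇒≤ᵈ = PartialOrderOn.⊑⇒⇒ ≤ᵈ-partialOrder f-po f⊑≤ᵈ in
      mk≐ f⇒≤ᵈ (≤ᵈ-least f-po (RootedTree.lowerSetsTotal Π₁-dec f-po f-rt) f-nbd (≤ᵈ⇒D ∘ f⇒≤ᵈ))

  characterised-resp-≐ : ∀ {R R′} → R ≐ R′ → Characterised E π₁ R → Characterised E π₁ R′
  characterised-resp-≐ R≐R′ ((po , rt , nbd) , minimum) =
    (partialOrder-resp-≐ R≐R′ po , rootedTree-resp-≐ R≐R′ rt ,
     λ β β₂ u v βu βv → Sum.map (≐⇒⇒ R≐R′) (≐⇒⇒ R≐R′) (nbd β β₂ u v βu βv)) ,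
    λ f f-cond f⊑R′ → ≐-trans (minimum f f-cond (⊑-resp-≐ R≐R′ f⊑R′)) R≐R′

  ordTilde⇒characterised : ∀ {R} → IsOrdTilde E π₁ R → Characterised E π₁ R
  ordTilde⇒characterised (D , D-linear , R≐≤ᵈ) =
    characterised-resp-≐ (≐-sym R≐≤ᵈ) (OrderOf.≤ᵈ-characterised D D-linear)

  characterised⇒ordTilde : ∀ {R} → Characterised E π₁ R → IsOrdTilde E π₁ R
  characterised⇒ordTilde {R} ((R-po , R-rt , R-nbd) , minimum) =
    _⊴_ , ⊴-linear , ≐-sym (minimum _≤ᵈ_ ≤ᵈ-cond₁₂ (⇒⇒⊑ ≤ᵈ⇒R))
    where
    module R = RootedTree Π₁-dec R-po R-rt
    open LinearExtension R-po R.≤-dec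
    open OrderOf _⊴_ ⊴-linear
    ≤ᵈ⇒R : _≤ᵈ_ ⇒ R
    ≤ᵈ⇒R = ≤ᵈ-least R-po R.lowerSetsTotal R-nbd ≤⇒⊴

  module Lifting {R : Rel (Fin n) 0ℓ} (R-po : IsPartialOrderOn Π₁ R) where
    open PartialOrderOn R-po

    -- every chain of the lifting is a chain of R followed by at most one edge of o
    LiftNF : Rel (Fin n) 0ℓ
    LiftNF x y = x ≡ y ⊎ R x y ⊎ ∃ λ a → R x a × PrincOrient E π₁ a y

    lift-normalForm : Lift E π₁ R ⇒ LiftNF
    lift-normalForm ε = inj₁ refl
    lift-normalForm (inj₁ xRz ◅ z↝y) with lift-normalForm z↝y
    ... | inj₁ refl = inj₂ (inj₁ xRz)
    ... | inj₂ (inj₁ zRy) = inj₂ (inj₁ (≤-trans xRz zRy))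
    ... | inj₂ (inj₂ (a , zRa , ay)) = inj₂ (inj₂ (a , ≤-trans xRz zRa , ay))
    lift-normalForm (inj₂ xz@(_ , x₁ , z₂) ◅ z↝y) with lift-normalForm z↝y
    ... | inj₁ refl = inj₂ (inj₂ (_ , ≤-refl x₁ , xz))
    ... | inj₂ (inj₁ zRy) = ⊥-elim (Π₁⇒¬Π₂ (proj₁ (≤-dom zRy)) z₂)
    ... | inj₂ (inj₂ (_ , zRa , _)) = ⊥-elim (Π₁⇒¬Π₂ (proj₁ (≤-dom zRa)) z₂)

    embed : R ⇒ Lift E π₁ R
    embed xRy = inj₁ xRy ◅ ε

    normalForm⇒lift : LiftNF ⇒ Lift E π₁ R
    normalForm⇒lift (inj₁ refl) = ε
    normalForm⇒lift (inj₂ (inj₁ xRy)) = embed xRy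
    normalForm⇒lift (inj₂ (inj₂ (_ , xRa , ay))) = inj₁ xRa ◅ inj₂ ay ◅ ε

    lift-into-Π₁ : ∀ {x y} → Π₁ y → Lift E π₁ R x y → R x y
    lift-into-Π₁ y₁ x↝y with lift-normalForm x↝y
    ... | inj₁ refl = ≤-refl y₁
    ... | inj₂ (inj₁ xRy) = xRy
    ... | inj₂ (inj₂ (_ , _ , _ , _ , y₂)) = ⊥-elim (Π₁⇒¬Π₂ y₁ y₂)

    lift-from-Π₂ : ∀ {x y} → Π₂ x → Lift E π₁ R x y → x ≡ y
    lift-from-Π₂ x₂ x↝y with lift-normalForm x↝y
    ... | inj₁ x≡y = x≡y
    ... | inj₂ (inj₁ xRy) = ⊥-elim (Π₁⇒¬Π₂ (proj₁ (≤-dom xRy)) x₂)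
    ... | inj₂ (inj₂ (_ , xRa , _)) = ⊥-elim (Π₁⇒¬Π₂ (proj₁ (≤-dom xRa)) x₂)

    lift-partialOrder : IsPartialOrderOn Everything (Lift E π₁ R)
    lift-partialOrder = (λ _ _ _ → tt , tt) , (λ _ _ → ε) , antisym , λ _ _ _ → _◅◅_
      where
      antisym : ∀ x y → Lift E π₁ R x y → Lift E π₁ R y x → x ≡ y
      antisym x y x↝y y↝x with lift-normalForm x↝y
      ... | inj₁ x≡y = x≡y
      ... | inj₂ (inj₁ xRy) = ≤-antisym xRy (lift-into-Π₁ (proj₁ (≤-dom xRy)) y↝x)
      ... | inj₂ (inj₂ (_ , _ , _ , _ , y₂)) = sym (lift-from-Π₂ y₂ y↝x)

    lift-dec : Decidable R → Decidable (Lift E π₁ R)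
    lift-dec R? x y =
      map′ normalForm⇒lift lift-normalForm
        (x ≟ y ⊎-dec R? x y ⊎-dec any? λ a → R? x a ×-dec PrincOrient-dec a y)

    lift-least-element : ∀ {r} → (∀ {x} → Π₁ x → R r x) → ∀ {x} → Everything x → Lift E π₁ R r x
    lift-least-element r≤ {x} _ with side x
    ... | inj₁ x₁ = embed (r≤ x₁)
    ... | inj₂ x₂ with Π₂-neighbour x₂
    ...   | a , xa = inj₁ (r≤ (edge-from-Π₂ x₂ xa)) ◅ inj₂ (E-sym xa , edge-from-Π₂ x₂ xa , x₂) ◅ ε

    lift-lowerSetsTotal : LowerSetsTotal R → NbdTotal E π₁ R → LowerSetsTotal (Lift E π₁ R)
    lift-lowerSetsTotal chains nbd {x} {y} {z} x↝z y↝z with side z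
    ... | inj₁ z₁ = Sum.map embed embed (chains (lift-into-Π₁ z₁ x↝z) (lift-into-Π₁ z₁ y↝z))
    ... | inj₂ z₂ with lift-normalForm x↝z | lift-normalForm y↝z
    ...   | inj₁ refl | _ = inj₂ y↝z
    ...   | _ | inj₁ refl = inj₁ x↝z
    ...   | inj₂ (inj₁ xRz) | _ = ⊥-elim (Π₁⇒¬Π₂ (proj₂ (≤-dom xRz)) z₂)
    ...   | _ | inj₂ (inj₁ yRz) = ⊥-elim (Π₁⇒¬Π₂ (proj₂ (≤-dom yRz)) z₂)
    ...   | inj₂ (inj₂ (a , xRa , az , _)) | inj₂ (inj₂ (b , yRb , bz , _))
      with nbd z z₂ a b (E-sym az) (E-sym bz)
    ...     | inj₁ aRb = Sum.map embed embed (chains (≤-trans xRa aRb) yRb)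
    ...     | inj₂ bRa = Sum.map embed embed (chains xRa (≤-trans yRb bRa))

  module LiftedOrder (D : Rel (Fin n) 0ℓ) (D-linear : IsLinearOrderOn Π₁ D) where
    open OrderOf D D-linear public
    open Lifting ≤ᵈ-partialOrder public

    lift-cond₁₂₃ : Cond₁₂₃ E π₁ (Lift E π₁ _≤ᵈ_)
    lift-cond₁₂₃ =
      lift-partialOrder ,
      PartialOrderOn.rootedTree lift-partialOrder (lift-dec ≤ᵈ-dec) dRoot tt (lift-least-element dRoot-least)
        (lift-lowerSetsTotal ≤ᵈ-lowerSetsTotal ≤ᵈ-nbdTotal) ,
      (λ α β αβ α₁ β₂ → inj₂ (αβ , α₁ , β₂) ◅ ε , Π₁-Π₂-distinct α₁ β₂) ,
      λ β β′ β₂ _ β≢β′ β↝β′ → β≢β′ (lift-from-Π₂ β₂ β↝β′)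

    lift-≤ᵈ-least : ∀ {f} → Cond₁₂₃ E π₁ f → Restrict Π₁ f ⇒ D → Lift E π₁ _≤ᵈ_ ⇒ f
    lift-≤ᵈ-least {f} (f-po , f-rt , f-orient , _) f₁⇒D =
      Star.fold f (λ step z≤y → ≤-trans (step⇒f step) z≤y) (≤-refl tt)
      where
      open PartialOrderOn f-po
      module F = RootedTree (λ _ → yes tt) f-po f-rt
      restrict-comparable : ∀ {x y} → Π₁ x → Π₁ y → f x y ⊎ f y x →
                            Restrict Π₁ f x y ⊎ Restrict Π₁ f y x
      restrict-comparable x₁ y₁ = Sum.map (_, x₁ , y₁) (_, y₁ , x₁)
      f₁-chains : LowerSetsTotal (Restrict Π₁ f)
      f₁-chains (x≤z , x₁ , _) (y≤z , y₁ , _) = restrict-comparable x₁ y₁ (F.lowerSetsTotal x≤z y≤z)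
      f₁-nbd : NbdTotal E π₁ (Restrict Π₁ f)
      f₁-nbd β β₂ u v βu βv =
        restrict-comparable u₁ v₁ (F.lowerSetsTotal (proj₁ (f-orient u β (E-sym βu) u₁ β₂))
                                                   (proj₁ (f-orient v β (E-sym βv) v₁ β₂)))
        where
        u₁ : Π₁ u
        u₁ = edge-from-Π₂ β₂ βu
        v₁ : Π₁ v
        v₁ = edge-from-Π₂ β₂ βv
      step⇒f : ∀ {x y} → x ≤ᵈ y ⊎ PrincOrient E π₁ x y → f x y
      step⇒f (inj₁ x≤ᵈy) = proj₁ (≤ᵈ-least (restrict-partialOrder f-po) f₁-chains f₁-nbd f₁⇒D x≤ᵈy)
      step⇒f (inj₂ (xy , x₁ , y₂)) = proj₁ (f-orient _ _ xy x₁ y₂)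

    lift-ordΠ : IsOrdΠ E π₁ (Lift E π₁ _≤ᵈ_)
    lift-ordΠ = lift-cond₁₂₃ , λ f f-cond f⊑L →
      let f⇒L = PartialOrderOn.⊑⇒⇒ lift-partialOrder (proj₁ f-cond) f⊑L in
      mk≐ f⇒L (lift-≤ᵈ-least f-cond λ (xfy , _ , y₁) → ≤ᵈ⇒D (lift-into-Π₁ y₁ (f⇒L xfy)))

    lift-determined : ∀ {e} → IsOrdΠ E π₁ e → Restrict Π₁ e ⇒ D → Lift E π₁ _≤ᵈ_ ≐ e
    lift-determined (e-cond , minimum) e₁⇒D =
      minimum _ lift-cond₁₂₃ (⇒⇒⊑ (lift-≤ᵈ-least e-cond e₁⇒D))

  ordΠ-resp-≐ : ∀ {e e′} → e ≐ e′ → IsOrdΠ E π₁ e → IsOrdΠ E π₁ e′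
  ordΠ-resp-≐ e≐e′ ((po , rt , orient , incomparable) , minimum) =
    (partialOrder-resp-≐ e≐e′ po , rootedTree-resp-≐ e≐e′ rt ,
     (λ α β αβ α₁ β₂ → strict-resp-≐ e≐e′ (orient α β αβ α₁ β₂)) ,
     λ β β′ β₂ β′₂ β≢β′ → incomparable β β′ β₂ β′₂ β≢β′ ∘ ≐⇒⇒ (≐-sym e≐e′)) ,
    λ f f-cond f⊑e′ → ≐-trans (minimum f f-cond (⊑-resp-≐ e≐e′ f⊑e′)) e≐e′

  lift-resp-≐ : ∀ {R R′} → R ≐ R′ → Lift E π₁ R ≐ Lift E π₁ R′
  lift-resp-≐ R≐R′ = mk≐ (Star.map (Sum.map₁ (≐⇒⇒ R≐R′))) (Star.map (Sum.map₁ (≐⇒⇒ (≐-sym R≐R′))))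

  lift-ordTilde : ∀ d → IsOrdTilde E π₁ d → IsOrdΠ E π₁ (Lift E π₁ d)
  lift-ordTilde d (D , D-linear , d≐≤ᵈ) =
    ordΠ-resp-≐ (lift-resp-≐ (≐-sym d≐≤ᵈ)) (LiftedOrder.lift-ordΠ D D-linear)

  lift-injective : ∀ d d′ → IsOrdTilde E π₁ d → IsOrdTilde E π₁ d′ →
                   Lift E π₁ d ≐ Lift E π₁ d′ → d ≐ d′
  lift-injective d d′ d-ord d′-ord Ld≐Ld′ =
    mk≐ (unlift d-ord d′-ord Ld≐Ld′) (unlift d′-ord d-ord (≐-sym Ld≐Ld′))
    where
    order : ∀ {R} → IsOrdTilde E π₁ R → IsPartialOrderOn Π₁ R
    order = proj₁ ∘ proj₁ ∘ ordTilde⇒characterised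
    unlift : ∀ {R R′} → IsOrdTilde E π₁ R → IsOrdTilde E π₁ R′ → Lift E π₁ R ≐ Lift E π₁ R′ → R ⇒ R′
    unlift R-ord R′-ord LR≐LR′ xRy =
      Lifting.lift-into-Π₁ (order R′-ord) (proj₂ (PartialOrderOn.≤-dom (order R-ord) xRy))
        (≐⇒⇒ LR≐LR′ (inj₁ xRy ◅ ε))

  lift-surjective : ∀ e → IsOrdΠ E π₁ e →
                    Σ (Rel (Fin n) 0ℓ) λ d → IsOrdTilde E π₁ d × (Lift E π₁ d ≐ e)
  lift-surjective e e-ordΠ@((e-po , e-rt , _) , _) =
    _≤ᵈ_ , (D , D-linear , ≐-refl) , lift-determined e-ordΠ λ (xey , x₁ , y₁) → ≤⇒⊴ xey , x₁ , y₁
    where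
    open LinearExtension e-po (RootedTree.≤-dec (λ _ → yes tt) e-po e-rt)
    D : Rel (Fin n) 0ℓ
    D = Restrict Π₁ _⊴_
    D-linear : IsLinearOrderOn Π₁ D
    D-linear = restrict-linear ⊴-linear
    open LiftedOrder D D-linear

  Σo⇒Σe : ∀ c → IsLinearOrderOn Everything c → InΣ Everything (PrincOrient E π₁) c →
          Σ (Rel (Fin n) 0ℓ) λ e → IsOrdΠ E π₁ e × InΣ Everything (Strict e) c
  Σo⇒Σe c c-linear (_ , c-extends) =
    Lift E π₁ _≤ᵈ_ , lift-ordΠ , c-linear , C.strict-closure lift<⇒c<
    where
    module C = PartialOrderOn (proj₁ c-linear)
    open LiftedOrder (Restrict Π₁ c) (restrict-linear c-linear)
    lift<⇒c< : ∀ x y → Strict (Lift E π₁ _≤ᵈ_) x y → Strict c x y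
    lift<⇒c< x y (x↝y , x≢y) with lift-normalForm x↝y
    ... | inj₁ x≡y = ⊥-elim (x≢y x≡y)
    ... | inj₂ (inj₁ x≤ᵈy) = proj₁ (≤ᵈ⇒D x≤ᵈy) , x≢y
    ... | inj₂ (inj₂ (a , x≤ᵈa , ay)) = C.≤-<-trans (proj₁ (≤ᵈ⇒D x≤ᵈa)) (c-extends a y [ ay ])

  Σe⇒Σo : ∀ c → IsLinearOrderOn Everything c →
          (Σ (Rel (Fin n) 0ℓ) λ e → IsOrdΠ E π₁ e × InΣ Everything (Strict e) c) →
          InΣ Everything (PrincOrient E π₁) c
  Σe⇒Σo c c-linear (e , ((_ , _ , e-orient , _) , _) , _ , c-extends) =
    c-linear ,
    PartialOrderOn.strict-closure (proj₁ c-linear) λ x y (xy , x₁ , y₂) → c-extends x y [ e-orient x y xy x₁ y₂ ]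

  Σe-disjoint : ∀ c e e′ → IsOrdΠ E π₁ e → IsOrdΠ E π₁ e′ →
                InΣ Everything (Strict e) c → InΣ Everything (Strict e′) c → e ≐ e′
  Σe-disjoint c e e′ e-ordΠ e′-ordΠ (c-linear , c-extends) (_ , c-extends′) =
    ≐-trans (≐-sym (lift-determined e-ordΠ (restricted c-extends)))
            (lift-determined e′-ordΠ (restricted c-extends′))
    where
    open LiftedOrder (Restrict Π₁ c) (restrict-linear c-linear)
    restricted : ∀ {f} → Extends c (TransClosure (Strict f)) → Restrict Π₁ f ⇒ Restrict Π₁ c
    restricted extends (xfy , x₁ , y₁) = extends⇒⊇ (proj₁ c-linear) extends xfy , x₁ , y₁

theorem5p1 : (n : ℕ) (E : Rel (Fin n) 0ℓ) (π₁ : Fin n → Bool) →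
    IsTree E → IsPrincipalDecomposition E π₁ →
    Σ (Fin n) (In₁ π₁) →
    -- part 1
    (∀ R → IsOrdTilde E π₁ R ⇔ Characterised E π₁ R) ×
    -- part 2: the lifting is a bijection Ord~(Π₁) → Ord~_{Π₁,Π₂}(Π)
    ((∀ d → IsOrdTilde E π₁ d → IsOrdΠ E π₁ (Lift E π₁ d)) ×
     (∀ d d' → IsOrdTilde E π₁ d → IsOrdTilde E π₁ d' →
        Lift E π₁ d ≐ Lift E π₁ d' → d ≐ d') ×
     (∀ e → IsOrdΠ E π₁ e →
        Σ (Rel (Fin n) 0ℓ) λ d → IsOrdTilde E π₁ d × (Lift E π₁ d ≐ e))) ×
    -- part 3: Σ(o) is the disjoint union of the Σ(e)
    ((∀ c → IsLinearOrderOn Everything c →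
        InΣ Everything (PrincOrient E π₁) c ⇔
        (Σ (Rel (Fin n) 0ℓ) λ e → IsOrdΠ E π₁ e × InΣ Everything (Strict e) c)) ×
     (∀ c e e' → IsOrdΠ E π₁ e → IsOrdΠ E π₁ e' →
        InΣ Everything (Strict e) c → InΣ Everything (Strict e') c → e ≐ e'))
theorem5p1 n E π₁ tree principal Π₁-inhabited =
  (λ R → mk⇔ ordTilde⇒characterised characterised⇒ordTilde) ,
  (lift-ordTilde , lift-injective , lift-surjective) ,
  (λ c c-linear → mk⇔ (Σo⇒Σe c c-linear) (Σe⇒Σo c c-linear)) , Σe-disjoint
  where open PrincipalDecomposition E π₁ tree principal Π₁-inhabited
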